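{- Let $\pi$ be a chromosome and let $\pi'$ be obtained from $\pi$ by performing a symmetric reversal. Then $\mathcal{A}[\pi]=\mathcal{A}[\pi']$.
   Context: Fix genes $\Sigma_1$ and repeats $\Sigma_2\ni r_0$. A chromosome is a sequence $\pi=[x_0,\dots,x_{n+1}]$ of signed symbols ($x_i=\pm a$, $|x_i|=a$) with $x_0=+r_0$, $x_{n+1}=-r_0$, every gene occurring exactly once. A symmetric reversal $\rho(i,j)$ ($0\le i<j\le n+1$, $x_i=-x_j$) replaces $x_i,\dots,x_j$ by $-x_j,\dots,-x_i$. Nodes: $(l(x_i),r(x_i))=(a^h,a^t)$ if $x_i=+a$, $(a^t,a^h)$ if $x_i=-a$. $\mathcal{A}[\pi]$ is the multiset of unordered pairs $\langle r(x_i),l(x_{i+1})\rangle$, $0\le i\le n$. -}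

module Defs where

open import Data.Nat using (ℕ; zero; suc; _∸_; _<_)
open import Data.List using (List; []; _∷_; _++_; [_]; take; drop; reverse; map)
open import Data.Maybe using (Maybe; just; nothing)
open import Data.Product using (Σ; Σ-syntax; _×_; _,_)
open import Data.Sum using (_⊎_; inj₁; inj₂)
open import Relation.Binary.PropositionalEquality using (_≡_; refl; sym; trans)
open import Relation.Binary.Bundles using (Setoid)
open import Relation.Binary.Structures using (IsEquivalence)
import Data.List.Relation.Binary.Permutation.Setoid as PermS

data Sign : Set where
  ⊕ ⊖ : Sign

flip : Sign → Sign
flip ⊕ = ⊖
flip ⊖ = ⊕

data End : Set where
  h t : End

module _ (G R : Set) where
  -- symbols: genes Σ₁ = G and repeats Σ₂ = R
  Sym : Set
  Sym = G ⊎ R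

  SSym : Set
  SSym = Sign × Sym

  Ext : Set
  Ext = Sym × End

neg : {G R : Set} → SSym G R → SSym G R
neg (s , a) = (flip s , a)

lnode : {G R : Set} → SSym G R → Ext G R
lnode (⊕ , a) = (a , h)
lnode (⊖ , a) = (a , t)

rnode : {G R : Set} → SSym G R → Ext G R
rnode (⊕ , a) = (a , t)
rnode (⊖ , a) = (a , h)

-- safe 0-based indexing x_k
_‼_ : {A : Set} → List A → ℕ → Maybe A
[] ‼ _ = nothing
(x ∷ xs) ‼ zero = just x
(x ∷ xs) ‼ suc k = xs ‼ k

OccursOnce : {G R : Set} → List (SSym G R) → G → Set
OccursOnce {G} {R} π g =
  Σ[ k ∈ ℕ ] ((Σ[ s ∈ Sign ] (π ‼ k ≡ just (s , inj₁ g))) ×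
     (∀ k' (s' : Sign) → π ‼ k' ≡ just (s' , inj₁ g) → k' ≡ k))

IsChromosome : {G R : Set} → R → List (SSym G R) → Set
IsChromosome {G} {R} r0 π =
  (Σ[ mid ∈ List (SSym G R) ] (π ≡ ((⊕ , inj₂ r0) ∷ mid ++ [ (⊖ , inj₂ r0) ])))
  × (∀ (g : G) → OccursOnce π g)

-- reversal ρ(i,j): replaces x_i,…,x_j by -x_j,…,-x_i
reversal : {G R : Set} → List (SSym G R) → ℕ → ℕ → List (SSym G R)
reversal π i j =
  take i π ++ reverse (map neg (take (suc j ∸ i) (drop i π))) ++ drop (suc j) π

IsSymmetricReversal : {G R : Set} → List (SSym G R) → ℕ → ℕ → Set
IsSymmetricReversal {G} {R} π i j =
  i < j × (Σ[ x ∈ SSym G R ] ((π ‼ i ≡ just x) × (π ‼ j ≡ just (neg x))))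

adjList : {G R : Set} → List (SSym G R) → List (Ext G R × Ext G R)
adjList [] = []
adjList (x ∷ []) = []
adjList (x ∷ y ∷ rest) = (rnode x , lnode y) ∷ adjList (y ∷ rest)

data UPairEq {A : Set} : A × A → A × A → Set where
  same  : ∀ {a b} → UPairEq (a , b) (a , b)
  swap  : ∀ {a b} → UPairEq (a , b) (b , a)

UPairEq-trans : {A : Set} {p q r : A × A} → UPairEq p q → UPairEq q r → UPairEq p r
UPairEq-trans same q = q
UPairEq-trans swap same = swap
UPairEq-trans swap swap = same

UPair-setoid : Set → Setoid _ _
UPair-setoid A = record
  { Carrier = A × A
  ; _≈_ = UPairEq
  ; isEquivalence = record
      { refl = same
      ; sym = λ { same → same ; swap → swap }
      ; trans = UPairEq-trans } }

-- equality of multisets of unordered pairs: permutation up to swapping pairs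
_≈ₘ_ : {A : Set} → List (A × A) → List (A × A) → Set
_≈ₘ_ {A} = PermS._↭_ (UPair-setoid A)

SameAdjacencies : {G R : Set} → List (SSym G R) → List (SSym G R) → Set
SameAdjacencies π π' = adjList π ≈ₘ adjList π'

-- Write π = A ++ x ∷ B ++ -x ∷ C, with x at position i and -x at position j.
-- The reversal turns the segment S = x ∷ B ++ [ -x ] into its inversion, which
-- is again x ∷ (inverted B) ++ [ -x ] since the end symbols are opposite.
-- Hence the adjacencies crossing the segment boundaries are untouched, and
-- those inside S are reversed with each pair swapped, because r(-a) = l(a) and
-- l(-a) = r(a): as a multiset of unordered pairs nothing changes.
module Submission where

open import Defs
open import Data.Nat using (ℕ; zero; suc; _+_; _<_; s≤s)
open import Data.List using (List; []; _∷_; _++_; [_]; _∷ʳ_; take; drop; reverse; map; length)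
open import Data.List.Properties using (unfold-reverse; reverse-++; map-++; ++-assoc)
open import Data.Maybe using (just)
open import Data.Product using (Σ-syntax; _×_; _,_) renaming (swap to swapₚ)
open import Relation.Binary.PropositionalEquality using (_≡_; refl; sym; cong; cong₂; subst; module ≡-Reasoning)
import Data.List.Relation.Binary.Permutation.Setoid as Perm
import Data.List.Relation.Binary.Permutation.Setoid.Properties as PermProps
import Data.List.Relation.Binary.Pointwise as Pointwise

module _ {A : Set} where
  open Perm (UPair-setoid A)
  open PermProps (UPair-setoid A)

  reverse-map-swap-↭ : (ps : List (A × A)) → reverse (map swapₚ ps) ↭ ps
  reverse-map-swap-↭ ps = ↭-trans (↭-reverse (map swapₚ ps)) (↭-reflexive-≋ (map-swap-≋ ps))
    where
    map-swap-≋ : (ps : List (A × A)) → Pointwise.Pointwise UPairEq (map swapₚ ps) ps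
    map-swap-≋ []      = Pointwise.[]
    map-swap-≋ (_ ∷ ps) = swap Pointwise.∷ map-swap-≋ ps

  ↭-++-middle : (xs : List (A × A)) {ys ys′ : List (A × A)} (zs : List (A × A)) →
    ys ↭ ys′ → xs ++ ys ++ zs ↭ xs ++ ys′ ++ zs
  ↭-++-middle xs zs p = ++⁺ˡ xs (++⁺ʳ zs p)

module _ {A : Set} where
  take-suc-length-++ : (xs : List A) (y : A) (ys : List A) →
    take (suc (length xs)) (xs ++ y ∷ ys) ≡ xs ∷ʳ y
  take-suc-length-++ []       y ys = refl
  take-suc-length-++ (x ∷ xs) y ys = cong (x ∷_) (take-suc-length-++ xs y ys)

  drop-suc-length-++ : (xs : List A) (y : A) (ys : List A) →
    drop (suc (length xs)) (xs ++ y ∷ ys) ≡ ys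
  drop-suc-length-++ []       y ys = refl
  drop-suc-length-++ (x ∷ xs) y ys = drop-suc-length-++ xs y ys

  ‼-split : (π : List A) {x : A} (i : ℕ) → π ‼ i ≡ just x →
    Σ[ xs ∈ List A ] Σ[ ys ∈ List A ] (π ≡ xs ++ x ∷ ys × length xs ≡ i)
  ‼-split (_ ∷ π) zero    refl = [] , π , refl , refl
  ‼-split (z ∷ π) (suc i) πᵢ with ‼-split π i πᵢ
  ... | xs , ys , refl , refl = z ∷ xs , ys , refl , refl

  ‼-split₂ : (π : List A) {x y : A} {i j : ℕ} → i < j → π ‼ i ≡ just x → π ‼ j ≡ just y →
    Σ[ xs ∈ List A ] Σ[ ys ∈ List A ] Σ[ zs ∈ List A ]
      (π ≡ xs ++ x ∷ ys ++ y ∷ zs × length xs ≡ i × length xs + suc (length ys) ≡ j)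
  ‼-split₂ (_ ∷ π) {i = zero}  {suc j} _ refl πⱼ with ‼-split π j πⱼ
  ... | ys , zs , refl , refl = [] , ys , zs , refl , refl , refl
  ‼-split₂ (z ∷ π) {i = suc i} {suc j} (s≤s i<j) πᵢ πⱼ with ‼-split₂ π i<j πᵢ πⱼ
  ... | xs , ys , zs , refl , refl , refl = z ∷ xs , ys , zs , refl , refl , refl

module _ {G R : Set} where
  neg-involutive : (x : SSym G R) → neg (neg x) ≡ x
  neg-involutive (⊕ , _) = refl
  neg-involutive (⊖ , _) = refl

  rnode-neg : (x : SSym G R) → rnode (neg x) ≡ lnode x
  rnode-neg (⊕ , _) = refl
  rnode-neg (⊖ , _) = refl

  lnode-neg : (x : SSym G R) → lnode (neg x) ≡ rnode x
  lnode-neg (⊕ , _) = refl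
  lnode-neg (⊖ , _) = refl

  invert : List (SSym G R) → List (SSym G R)
  invert xs = reverse (map neg xs)

  invert-∷ : (x : SSym G R) (xs : List (SSym G R)) → invert (x ∷ xs) ≡ invert xs ∷ʳ neg x
  invert-∷ x xs = unfold-reverse (neg x) (map neg xs)

  invert-flanked : (x : SSym G R) (xs : List (SSym G R)) →
    invert (x ∷ xs ∷ʳ neg x) ≡ x ∷ invert xs ∷ʳ neg x
  invert-flanked x xs = begin
    invert (x ∷ xs ∷ʳ neg x)                        ≡⟨ invert-∷ x (xs ∷ʳ neg x) ⟩
    reverse (map neg (xs ∷ʳ neg x)) ∷ʳ neg x        ≡⟨ cong (λ ys → reverse ys ∷ʳ neg x) (map-++ neg xs [ neg x ]) ⟩
    reverse (map neg xs ∷ʳ neg (neg x)) ∷ʳ neg x    ≡⟨ cong (_∷ʳ neg x) (reverse-++ (map neg xs) [ neg (neg x) ]) ⟩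
    neg (neg x) ∷ invert xs ∷ʳ neg x                ≡⟨ cong (λ y → y ∷ invert xs ∷ʳ neg x) (neg-involutive x) ⟩
    x ∷ invert xs ∷ʳ neg x                          ∎
    where open ≡-Reasoning

  adjList-++-∷ : (xs : List (SSym G R)) (y : SSym G R) (ys : List (SSym G R)) →
    adjList (xs ++ y ∷ ys) ≡ adjList (xs ∷ʳ y) ++ adjList (y ∷ ys)
  adjList-++-∷ []           y ys = refl
  adjList-++-∷ (x ∷ [])     y ys = refl
  adjList-++-∷ (x ∷ x′ ∷ xs) y ys = cong ((rnode x , lnode x′) ∷_) (adjList-++-∷ (x′ ∷ xs) y ys)

  adjList-∷ʳ-∷ʳ : (xs : List (SSym G R)) (x y : SSym G R) →
    adjList (xs ∷ʳ x ∷ʳ y) ≡ adjList (xs ∷ʳ x) ∷ʳ (rnode x , lnode y)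
  adjList-∷ʳ-∷ʳ xs x y = begin
    adjList (xs ∷ʳ x ∷ʳ y)        ≡⟨ cong adjList (++-assoc xs [ x ] [ y ]) ⟩
    adjList (xs ++ x ∷ [ y ])     ≡⟨ adjList-++-∷ xs x [ y ] ⟩
    adjList (xs ∷ʳ x) ∷ʳ (rnode x , lnode y) ∎
    where open ≡-Reasoning

  adjList-invert : (xs : List (SSym G R)) → adjList (invert xs) ≡ reverse (map swapₚ (adjList xs))
  adjList-invert []           = refl
  adjList-invert (x ∷ [])     = refl
  adjList-invert (x ∷ y ∷ xs) = begin
    adjList (invert (x ∷ y ∷ xs))
      ≡⟨ cong adjList (invert-∷ x (y ∷ xs)) ⟩
    adjList (invert (y ∷ xs) ∷ʳ neg x)
      ≡⟨ cong (λ ys → adjList (ys ∷ʳ neg x)) (invert-∷ y xs) ⟩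
    adjList (invert xs ∷ʳ neg y ∷ʳ neg x)
      ≡⟨ adjList-∷ʳ-∷ʳ (invert xs) (neg y) (neg x) ⟩
    adjList (invert xs ∷ʳ neg y) ∷ʳ (rnode (neg y) , lnode (neg x))
      ≡⟨ cong₂ (λ ys p → adjList ys ∷ʳ p) (sym (invert-∷ y xs)) (cong₂ _,_ (rnode-neg y) (lnode-neg x)) ⟩
    adjList (invert (y ∷ xs)) ∷ʳ (lnode y , rnode x)
      ≡⟨ cong (_∷ʳ (lnode y , rnode x)) (adjList-invert (y ∷ xs)) ⟩
    reverse (map swapₚ (adjList (y ∷ xs))) ∷ʳ (lnode y , rnode x)
      ≡⟨ sym (unfold-reverse (lnode y , rnode x) (map swapₚ (adjList (y ∷ xs)))) ⟩
    reverse (map swapₚ (adjList (x ∷ y ∷ xs))) ∎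
    where open ≡-Reasoning

  adjList-flanked : (xs : List (SSym G R)) (x : SSym G R) (ys : List (SSym G R)) (y : SSym G R)
    (zs : List (SSym G R)) →
    adjList (xs ++ x ∷ ys ++ y ∷ zs) ≡ adjList (xs ∷ʳ x) ++ adjList (x ∷ ys ∷ʳ y) ++ adjList (y ∷ zs)
  adjList-flanked xs x ys y zs = begin
    adjList (xs ++ x ∷ ys ++ y ∷ zs)
      ≡⟨ adjList-++-∷ xs x (ys ++ y ∷ zs) ⟩
    adjList (xs ∷ʳ x) ++ adjList (x ∷ ys ++ y ∷ zs)
      ≡⟨ cong (adjList (xs ∷ʳ x) ++_) (adjList-++-∷ (x ∷ ys) y zs) ⟩
    adjList (xs ∷ʳ x) ++ adjList (x ∷ ys ∷ʳ y) ++ adjList (y ∷ zs) ∎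
    where open ≡-Reasoning

  adjList-invert-symmetric : (xs : List (SSym G R)) (x : SSym G R) (ys zs : List (SSym G R)) →
    adjList (xs ++ x ∷ ys ++ neg x ∷ zs) ≈ₘ adjList (xs ++ x ∷ invert ys ++ neg x ∷ zs)
  adjList-invert-symmetric xs x ys zs
    rewrite adjList-flanked xs x ys (neg x) zs | adjList-flanked xs x (invert ys) (neg x) zs =
    ↭-++-middle (adjList (xs ∷ʳ x)) (adjList (neg x ∷ zs)) (Perm.↭-sym (UPair-setoid _) segment-↭)
    where
    segment-↭ : adjList (x ∷ invert ys ∷ʳ neg x) ≈ₘ adjList (x ∷ ys ∷ʳ neg x)
    segment-↭ rewrite sym (invert-flanked x ys) | adjList-invert (x ∷ ys ∷ʳ neg x) =
      reverse-map-swap-↭ (adjList (x ∷ ys ∷ʳ neg x))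

  reversal-segment : (xs : List (SSym G R)) (x : SSym G R) (ys : List (SSym G R)) (y : SSym G R)
    (zs : List (SSym G R)) →
    reversal (xs ++ x ∷ ys ++ y ∷ zs) (length xs) (length xs + suc (length ys))
      ≡ xs ++ invert (x ∷ ys ∷ʳ y) ++ zs
  reversal-segment (x′ ∷ xs) x ys y zs = cong (x′ ∷_) (reversal-segment xs x ys y zs)
  reversal-segment []        x ys y zs =
    cong₂ (λ segment rest → invert (x ∷ segment) ++ rest)
      (take-suc-length-++ ys y zs) (drop-suc-length-++ ys y zs)

  reversal-symmetric : (xs : List (SSym G R)) (x : SSym G R) (ys zs : List (SSym G R)) →
    reversal (xs ++ x ∷ ys ++ neg x ∷ zs) (length xs) (length xs + suc (length ys))
      ≡ xs ++ x ∷ invert ys ++ neg x ∷ zs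
  reversal-symmetric xs x ys zs = begin
    reversal (xs ++ x ∷ ys ++ neg x ∷ zs) (length xs) (length xs + suc (length ys))
      ≡⟨ reversal-segment xs x ys (neg x) zs ⟩
    xs ++ invert (x ∷ ys ∷ʳ neg x) ++ zs
      ≡⟨ cong (λ segment → xs ++ segment ++ zs) (invert-flanked x ys) ⟩
    xs ++ (x ∷ invert ys ∷ʳ neg x) ++ zs
      ≡⟨ cong (λ segment → xs ++ x ∷ segment) (++-assoc (invert ys) [ neg x ] zs) ⟩
    xs ++ x ∷ invert ys ++ neg x ∷ zs ∎
    where open ≡-Reasoning

lemma1 : {G R : Set} (r0 : R) (π : List (SSym G R)) (i j : ℕ) →
    IsChromosome r0 π → IsSymmetricReversal π i j →
    SameAdjacencies π (reversal π i j)
lemma1 r0 π i j _ (i<j , x , πᵢ , πⱼ) with ‼-split₂ π i<j πᵢ πⱼ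
... | xs , ys , zs , refl , refl , refl =
  subst (SameAdjacencies (xs ++ x ∷ ys ++ neg x ∷ zs)) (sym (reversal-symmetric xs x ys zs))
    (adjList-invert-symmetric xs x ys zs)
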